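{- Let $(\Gamma,\tau)$ be a $z$-oriented triangulation of a connected closed surface, and let $\Gamma_\tau$ be its transition digraph. Then (1) for every vertex $v$ there exists a closed directed walk of length $3$ in $\Gamma_\tau$ passing through $v$; (2) the Markov chain $\mathcal{X}_\tau$ is irreducible.
   Context: A triangulation $\Gamma$ of a connected closed $2$-dimensional surface $M$ (not necessarily orientable) is a closed $2$-cell embedding of a connected finite simple graph in $M$ in which every face is a triangle. Two edges are adjacent if they are distinct and lie in a common face. A zigzag is a cyclic sequence of edges $e_1,\dots,e_n$ (indices mod $n$, $n$ minimal) such that for all $i$: $e_i,e_{i+1}$ are adjacent, the faces containing $\{e_i,e_{i+1}\}$ and $\{e_{i+1},e_{i+2}\}$ are adjacent (distinct and share an edge), and $e_i,e_{i+2}$ are disjoint; written as a cyclic vertex sequence $v_1,\dots,v_n$ with $e_i=v_iv_{i+1}$, it traverses $e_i$ from $v_i$ to $v_{i+1}$. The reverse $Z^{ -1}$ traverses the edges in opposite order. A $z$-orientation $\tau$ contains, for every zigzag $Z$, exactly one of $Z,Z^{ -1}$. Each edge is traversed exactly twice in total by the zigzags of $\tau$; it is of type I if the two traversals are in opposite directions, of type II (and directed accordingly) if in the same direction. Every face either has two type I edges and one type II edge (type I face) or three type II edges forming a directed cycle (type II face). The transition digraph $\Gamma_\tau$ has vertex set $V$ of $\Gamma$, with both directed edges $v\to w$ and $w\to v$ for each type I edge $vw$ and the single directed edge $v\to w$ for each type II edge directed from $v$ to $w$. The Markov chain $\mathcal{X}_\tau$ has state space $V$ and transitions: for $v\in V$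 let $d(v)$ be the number of type I edges at $v$ plus twice the number of type II edges directed out of $v$; $p(v_i,v_j)=1/d(v_i)$ if $v_iv_j$ is of type I, $2/d(v_i)$ if $v_iv_j$ is of type II directed from $v_i$ to $v_j$, and $0$ otherwise. Walks in $\Gamma_\tau$ are directed; length counts edges with multiplicity. -}

module Defs where

open import Data.Nat as ℕ using (ℕ; zero; suc)
open import Data.Fin as Fin using (Fin)
open import Data.Integer as ℤ using (ℤ; +_)
open import Data.Rational as ℚ using (ℚ; 0ℚ; 1ℚ)
open import Data.Bool using (Bool; true; false; if_then_else_; _∧_)
open import Data.List using (List; length; lookup; []; _∷_)
open import Data.Product using (Σ; _×_; _,_)
open import Data.Sum using (_⊎_)
open import Relation.Nullary using (¬_)
open import Relation.Nullary.Decidable using (⌊_⌋)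
open import Relation.Binary.PropositionalEquality using (_≡_; _≢_)
open import Relation.Binary.Construct.Closure.ReflexiveTransitive using (Star)

-- Faces are unordered triples of distinct vertices,
-- given by a predicate Face that is invariant under permutations.
-- Closed surface: every edge lies in exactly two faces and the link of
-- every vertex is connected (hence a cycle); the graph is connected.

record Triangulation (n : ℕ) : Set₁ where
  field
    Face       : Fin n → Fin n → Fin n → Set
    face-swap₁ : ∀ {a b c} → Face a b c → Face b a c
    face-swap₂ : ∀ {a b c} → Face a b c → Face a c b
    face-irr   : ∀ {a b c} → Face a b c → a ≢ b

  Edge : Fin n → Fin n → Set
  Edge a b = Σ (Fin n) λ c → Face a b c

  Link : Fin n → Fin n → Fin n → Set
  Link v a b = Face v a b

  field
    edge-two : ∀ {a b} → Edge a b →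
      Σ (Fin n) λ c → Σ (Fin n) λ d →
        c ≢ d × Face a b c × Face a b d ×
        (∀ e → Face a b e → e ≡ c ⊎ e ≡ d)
    link-connected : ∀ v {a b} → Edge v a → Edge v b → Star (Link v) a b
    vertex-in-face : ∀ v → Σ (Fin n) λ a → Σ (Fin n) λ b → Face v a b
    connected : ∀ a b → Star Edge a b

-- Zigzags, as cyclic vertex sequences v : ℤ → V of period len,
-- with e_i = v_i v_{i+1} traversed from v_i to v_{i+1}.

module _ {n : ℕ} (T : Triangulation n) where
  open Triangulation T

  SameEdge : Fin n → Fin n → Fin n → Fin n → Set
  SameEdge a b c d = (a ≡ c × b ≡ d) ⊎ (a ≡ d × b ≡ c)

  -- conditions on four consecutive vertices a=v_i, b=v_{i+1}, c=v_{i+2}, d=v_{i+3}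
  ZigzagStep : Fin n → Fin n → Fin n → Fin n → Set
  ZigzagStep a b c d =
    -- e_i = ab and e_{i+1} = bc are adjacent: distinct, in a common face
    (a ≢ c × Face a b c) ×
    -- the faces abc and bcd containing {e_i,e_{i+1}} and {e_{i+1},e_{i+2}}
    -- are adjacent: they share bc, and are distinct
    (Face b c d × ¬ (d ≡ a)) ×
    (a ≢ c × a ≢ d × b ≢ c × b ≢ d)

  record Zigzag : Set where
    field
      len      : ℕ
      len>0    : 0 ℕ.< len
      vtx      : ℤ → Fin n
      periodic : ∀ i → vtx (i ℤ.+ + len) ≡ vtx i
      step     : ∀ i → ZigzagStep (vtx i) (vtx (i ℤ.+ + 1))
                                  (vtx (i ℤ.+ + 2)) (vtx (i ℤ.+ + 3))
      minimal  : ∀ m → 0 ℕ.< m → m ℕ.< len →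
                 ¬ (∀ i → SameEdge (vtx i) (vtx (i ℤ.+ + 1))
                                   (vtx (i ℤ.+ + m)) (vtx (i ℤ.+ + m ℤ.+ + 1)))
  open Zigzag public

  SameCyclic : Zigzag → Zigzag → Set
  SameCyclic Z W = Σ ℤ λ s → ∀ i → vtx W i ≡ vtx Z (i ℤ.+ s)

  IsReverse : Zigzag → Zigzag → Set
  IsReverse W Z = Σ ℤ λ s → ∀ i → vtx W i ≡ vtx Z (s ℤ.- i)

  countTo : ℕ → (ℕ → Bool) → ℕ
  countTo zero    f = 0
  countTo (suc k) f = countTo k f ℕ.+ (if f k then 1 else 0)

  travZ : Zigzag → Fin n → Fin n → ℕ
  travZ Z u w = countTo (len Z) λ i →
    ⌊ vtx Z (+ i) Fin.≟ u ⌋ ∧ ⌊ vtx Z (+ i ℤ.+ + 1) Fin.≟ w ⌋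

  -- z-orientation: a finite set (duplicate-free list up to cyclic shift)
  -- of zigzags containing exactly one of Z, Z⁻¹ for every zigzag Z
  record ZOrientation : Set where
    field
      zs       : List Zigzag
      distinct : ∀ i j → SameCyclic (lookup zs i) (lookup zs j) → i ≡ j
    Contains : Zigzag → Set
    Contains Z = Σ (Fin (length zs)) λ i → SameCyclic (lookup zs i) Z
    ContainsRev : Zigzag → Set
    ContainsRev Z = Σ (Fin (length zs)) λ i → IsReverse (lookup zs i) Z
    field
      choice   : ∀ Z → (Contains Z × ¬ ContainsRev Z) ⊎ (¬ Contains Z × ContainsRev Z)

  module _ (τ : ZOrientation) where
    open ZOrientation τ

    sumList : List Zigzag → Fin n → Fin n → ℕ
    sumList []       u w = 0
    sumList (Z ∷ Zs) u w = travZ Z u w ℕ.+ sumList Zs u w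

    trav : Fin n → Fin n → ℕ
    trav = sumList zs

    TypeI : Fin n → Fin n → Set
    TypeI u w = trav u w ≡ 1 × trav w u ≡ 1

    TypeII : Fin n → Fin n → Set
    TypeII u w = trav u w ≡ 2 × trav w u ≡ 0

    Arc : Fin n → Fin n → Set
    Arc u w = TypeI u w ⊎ TypeII u w

    weight : Fin n → Fin n → ℕ
    weight u w =
      if ⌊ trav u w ℕ.≟ 1 ⌋ ∧ ⌊ trav w u ℕ.≟ 1 ⌋ then 1
      else (if ⌊ trav u w ℕ.≟ 2 ⌋ ∧ ⌊ trav w u ℕ.≟ 0 ⌋ then 2 else 0)

    sumFinℕ : ∀ {k} → (Fin k → ℕ) → ℕ
    sumFinℕ {zero}  f = 0
    sumFinℕ {suc k} f = f Fin.zero ℕ.+ sumFinℕ (λ i → f (Fin.suc i))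

    sumFinℚ : ∀ {k} → (Fin k → ℚ) → ℚ
    sumFinℚ {zero}  f = 0ℚ
    sumFinℚ {suc k} f = f Fin.zero ℚ.+ sumFinℚ (λ i → f (Fin.suc i))

    deg : Fin n → ℕ
    deg v = sumFinℕ (weight v)

    prob : Fin n → Fin n → ℚ
    prob v w with deg v
    ... | zero  = 0ℚ
    ... | suc k = + weight v w ℚ./ suc k

    probPow : ℕ → Fin n → Fin n → ℚ
    probPow zero    v w = if ⌊ v Fin.≟ w ⌋ then 1ℚ else 0ℚ
    probPow (suc k) v w = sumFinℚ λ u → probPow k v u ℚ.* prob u w

    Irreducible : Set
    Irreducible = ∀ v w → Σ ℕ λ k → 0ℚ ℚ.< probPow k v w

module Submission where

-- A zigzag is determined by any three consecutive vertices, i.e. by a flag (a,b,c) of a face, and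
-- it runs through the flags of its faces in a cycle; so through each flag of a face passes exactly
-- one zigzag, and τ contains either it or its reverse.  Hence for every face abc exactly one of the
-- flags (a,b,c), (c,b,a) is used by τ, and the edge uw of a face uwc is traversed from u to w once
-- for each zigzag of τ through (u,w,c) or (c,u,w).  So two of the three rotations of (a,b,c), or two
-- of their reverses, are used, and either way every edge of the face becomes an arc of Γ_τ in one
-- cyclic orientation of the triangle: a closed walk of length 3.  As Γ is connected, Γ_τ is then
-- strongly connected, and its arcs carry positive transition probabilities.

open import Defs
open import Data.Nat using (ℕ)
open import Data.Fin using (Fin)
open import Data.Product using (Σ; _×_)

open import Data.Nat as ℕ using (zero; suc; _<_)
import Data.Nat.Properties as ℕP
open import Data.Nat.Induction using (<-rec)
import Data.Nat.Tactic.RingSolver as ℕ-Solver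
open import Algebra.Properties.CommutativeSemigroup ℕP.+-commutativeSemigroup
  using () renaming (interchange to +-interchange)
import Data.Fin as Fin
import Data.Fin.Properties as FinP
open import Data.Integer as ℤ using (ℤ; +_; -[1+_])
import Data.Integer.Properties as ℤP
open import Data.Integer.Tactic.RingSolver using (solve-∀)
open import Data.Rational as ℚ using (ℚ; 0ℚ; 1ℚ)
import Data.Rational.Properties as ℚP
open import Data.Product using (_,_; proj₁; proj₂)
import Data.Product.Properties as ×P
open import Data.Sum as Sum using (_⊎_; inj₁; inj₂)
open import Data.Bool using (Bool; if_then_else_; _∧_)
open import Data.List using (List; []; _∷_; lookup)
open import Data.Empty using (⊥-elim)
open import Function using (_∘_; _∋_)
open import Relation.Nullary using (¬_; Dec; yes; no)
open import Relation.Nullary.Decidable as Dec using (⌊_⌋; _×-dec_)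
open import Relation.Unary using (Decidable)
open import Relation.Binary using (tri<; tri≈; tri>)
open import Relation.Binary.Construct.Closure.ReflexiveTransitive using (Star; ε; _◅_; _⋆; foldl)
open import Relation.Binary.PropositionalEquality

ℤ-bi-induction : ∀ {p} (P : ℤ → Set p) → P (+ 0) →
                 (∀ i → P i → P (i ℤ.+ + 1)) → (∀ i → P (i ℤ.+ + 1) → P i) →
                 ∀ i → P i
ℤ-bi-induction P p₀ up down (+ zero)       = p₀
ℤ-bi-induction P p₀ up down (+ suc k)      =
  subst P (cong +_ (ℕP.+-comm k 1)) (up (+ k) (ℤ-bi-induction P p₀ up down (+ k)))
ℤ-bi-induction P p₀ up down -[1+ zero ]    = down -[1+ 0 ] p₀
ℤ-bi-induction P p₀ up down -[1+ suc k ]   = down -[1+ suc k ] (ℤ-bi-induction P p₀ up down -[1+ k ])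

least-witness : ∀ {p} {P : ℕ → Set p} → Decidable P → ∀ {m} → P m →
                Σ ℕ λ k → P k × (∀ {j} → j < k → ¬ P j)
least-witness {P = P} P? = <-rec (λ m → P m → Least) search _
  where
  Least : Set _
  Least = Σ ℕ λ k → P k × (∀ {j} → j < k → ¬ P j)
  search : ∀ m → (∀ {j} → j < m → P j → Least) → P m → Least
  search m smaller pm with ℕP.anyUpTo? P? m
  ... | yes (j , j<m , pj) = smaller j<m pj
  ... | no none            = m , pm , λ j<m pj → none (_ , j<m , pj)

+-right-comm : ∀ i j k → (i ℤ.+ j) ℤ.+ k ≡ (i ℤ.+ k) ℤ.+ j
+-right-comm = solve-∀

-- Either two of the Aᵢ hold or two of the Bᵢ, phrased as: every pair meets the majority side.
majority : ∀ {ℓ} {A₁ A₂ A₃ B₁ B₂ B₃ : Set ℓ} → A₁ ⊎ B₁ → A₂ ⊎ B₂ → A₃ ⊎ B₃ →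
           ((A₁ ⊎ A₃) × (A₂ ⊎ A₁) × (A₃ ⊎ A₂)) ⊎ ((B₂ ⊎ B₃) × (B₁ ⊎ B₂) × (B₃ ⊎ B₁))
majority (inj₁ a₁) (inj₁ a₂) _         = inj₁ (inj₁ a₁ , inj₁ a₂ , inj₂ a₂)
majority (inj₁ a₁) (inj₂ _)  (inj₁ a₃) = inj₁ (inj₁ a₁ , inj₂ a₁ , inj₁ a₃)
majority (inj₁ _)  (inj₂ b₂) (inj₂ b₃) = inj₂ (inj₁ b₂ , inj₂ b₂ , inj₁ b₃)
majority (inj₂ _)  (inj₁ a₂) (inj₁ a₃) = inj₁ (inj₂ a₃ , inj₁ a₂ , inj₁ a₃)
majority (inj₂ b₁) (inj₁ _)  (inj₂ b₃) = inj₂ (inj₂ b₃ , inj₁ b₁ , inj₁ b₃)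
majority (inj₂ b₁) (inj₂ b₂) _         = inj₂ (inj₁ b₂ , inj₁ b₁ , inj₂ b₁)

bit : Bool → ℕ
bit b = if b then 1 else 0

⌊⌋-×-dec : ∀ {p q} {P : Set p} {Q : Set q} (P? : Dec P) (Q? : Dec Q) →
           ⌊ P? ⌋ ∧ ⌊ Q? ⌋ ≡ ⌊ P? ×-dec Q? ⌋
⌊⌋-×-dec P? Q? =
  trans (cong₂ _∧_ (Dec.isYes≗does P?) (Dec.isYes≗does Q?)) (sym (Dec.isYes≗does (P? ×-dec Q?)))

bit-⊎ : ∀ {p q r} {P : Set p} {Q : Set q} {R : Set r} (P? : Dec P) (Q? : Dec Q) (R? : Dec R) →
        (P → Q ⊎ R) → (Q → P) → (R → P) → (Q → ¬ R) →
        bit ⌊ P? ⌋ ≡ bit ⌊ Q? ⌋ ℕ.+ bit ⌊ R? ⌋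
bit-⊎ (yes _) (yes q) (yes r) _     _   _   q⇒¬r = ⊥-elim (q⇒¬r q r)
bit-⊎ (yes _) (yes _) (no _)  _     _   _   _    = refl
bit-⊎ (yes _) (no _)  (yes _) _     _   _   _    = refl
bit-⊎ (yes p) (no ¬q) (no ¬r) p⇒q⊎r _   _   _    = ⊥-elim (Sum.[ ¬q , ¬r ] (p⇒q⊎r p))
bit-⊎ (no ¬p) (yes q) _       _     q⇒p _   _    = ⊥-elim (¬p (q⇒p q))
bit-⊎ (no ¬p) (no _)  (yes r) _     _   r⇒p _    = ⊥-elim (¬p (r⇒p r))
bit-⊎ (no _)  (no _)  (no _)  _     _   _   _    = refl

module _ {n : ℕ} (T : Triangulation n) where
  open Triangulation T

  private
    variable
      a b c d a′ b′ c′ d′ u w x y z : Fin n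

  count-none : ∀ L {P : ℕ → Set} (P? : Decidable P) → (∀ {k} → k < L → ¬ P k) →
               countTo T L (⌊_⌋ ∘ P?) ≡ 0
  count-none zero    P? none = refl
  count-none (suc L) P? none with P? L
  ... | yes p = ⊥-elim (none (ℕP.n<1+n L) p)
  ... | no _  = trans (ℕP.+-identityʳ _) (count-none L P? (none ∘ ℕP.m<n⇒m<1+n))

  count-unique : ∀ L {P : ℕ → Set} (P? : Decidable P) {r} → r < L → P r →
                 (∀ {k} → k < L → P k → k ≡ r) → countTo T L (⌊_⌋ ∘ P?) ≡ 1
  count-unique (suc L) P? {r} r<1+L pr unique with P? L
  ... | yes pL =
    cong (ℕ._+ 1) (count-none L P? λ k<L pk →
      ℕP.<-irrefl (trans (unique (ℕP.m<n⇒m<1+n k<L) pk) (sym (unique (ℕP.n<1+n L) pL))) k<L)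
  ... | no ¬pL =
    trans (ℕP.+-identityʳ _) (count-unique L P? r<L pr (unique ∘ ℕP.m<n⇒m<1+n))
    where
    r<L : r < L
    r<L = ℕP.≤∧≢⇒< (ℕP.≤-pred r<1+L) λ { refl → ¬pL pr }

  count-+ : ∀ L (g h₁ h₂ : ℕ → Bool) → (∀ {k} → k < L → bit (g k) ≡ bit (h₁ k) ℕ.+ bit (h₂ k)) →
            countTo T L g ≡ countTo T L h₁ ℕ.+ countTo T L h₂
  count-+ zero    g h₁ h₂ pointwise = refl
  count-+ (suc L) g h₁ h₂ pointwise
    rewrite count-+ L g h₁ h₂ (pointwise ∘ ℕP.m<n⇒m<1+n) | pointwise (ℕP.n<1+n L) =
    +-interchange (countTo T L h₁) (countTo T L h₂) (bit (h₁ L)) (bit (h₂ L))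

  Flag : Set
  Flag = Fin n × Fin n × Fin n

  flag-≡ : a ≡ a′ → b ≡ b′ → c ≡ c′ → (Flag ∋ (a , b , c)) ≡ (a′ , b′ , c′)
  flag-≡ refl refl refl = refl

  flag-injective : (Flag ∋ (a , b , c)) ≡ (a′ , b′ , c′) → a ≡ a′ × b ≡ b′ × c ≡ c′
  flag-injective refl = refl , refl , refl

  _≟-flag_ : (s t : Flag) → Dec (s ≡ t)
  _≟-flag_ = ×P.≡-dec Fin._≟_ (×P.≡-dec Fin._≟_ Fin._≟_)

  face-rotate : Face a b c → Face b c a
  face-rotate = face-swap₂ ∘ face-swap₁

  face-reverse : Face a b c → Face c b a
  face-reverse = face-swap₁ ∘ face-swap₂ ∘ face-swap₁

  third-unique : Face a b x → Face a b y → Face a b z → x ≢ z → y ≢ z → x ≡ y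
  third-unique fx fy fz x≢z y≢z with edge-two (_ , fx)
  ... | c , d , _ , _ , _ , only with only _ fx | only _ fy | only _ fz
  ... | inj₁ refl | inj₁ refl | _         = refl
  ... | inj₂ refl | inj₂ refl | _         = refl
  ... | inj₁ refl | inj₂ refl | inj₁ refl = ⊥-elim (x≢z refl)
  ... | inj₁ refl | inj₂ refl | inj₂ refl = ⊥-elim (y≢z refl)
  ... | inj₂ refl | inj₁ refl | inj₁ refl = ⊥-elim (y≢z refl)
  ... | inj₂ refl | inj₁ refl | inj₂ refl = ⊥-elim (x≢z refl)

  record SecondFace (u w c : Fin n) : Set where
    field
      apex      : Fin n
      face      : Face u w apex
      apex≢     : apex ≢ c
      two-faces : ∀ e → Face u w e → e ≡ c ⊎ e ≡ apex

  second-face : Face u w c → SecondFace u w c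
  second-face {c = c} fc with edge-two (c , fc)
  ... | c₀ , d₀ , c₀≢d₀ , fc₀ , fd₀ , only with only c fc
  ... | inj₁ refl = record { apex = d₀ ; face = fd₀ ; apex≢ = c₀≢d₀ ∘ sym ; two-faces = only }
  ... | inj₂ refl =
    record { apex = c₀ ; face = fc₀ ; apex≢ = c₀≢d₀ ; two-faces = λ e f → Sum.swap (only e f) }

  zigzagStep-≡ : a ≡ a′ → b ≡ b′ → c ≡ c′ → d ≡ d′ →
                 ZigzagStep T a b c d → ZigzagStep T a′ b′ c′ d′
  zigzagStep-≡ refl refl refl refl s = s

  zigzagStep-reverse : ZigzagStep T a b c d → ZigzagStep T d c b a
  zigzagStep-reverse ((a≢c , fabc) , (fbcd , d≢a) , (_ , a≢d , b≢c , b≢d)) =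
    (b≢d ∘ sym , face-reverse fbcd) , (face-reverse fabc , d≢a ∘ sym) ,
    (b≢d ∘ sym , d≢a , b≢c ∘ sym , a≢c ∘ sym)

  zigzagStep-next-unique : ZigzagStep T a b c d → ZigzagStep T a′ b′ c′ d′ →
                           a ≡ a′ → b ≡ b′ → c ≡ c′ → d ≡ d′
  zigzagStep-next-unique ((_ , fabc) , (fbcd , d≢a) , _) ((_ , _) , (fbcd′ , d′≢a) , _) refl refl refl =
    third-unique fbcd fbcd′ (face-rotate fabc) d≢a d′≢a

  zigzagStep-prev-unique : ZigzagStep T a b c d → ZigzagStep T a′ b′ c′ d′ →
                           b ≡ b′ → c ≡ c′ → d ≡ d′ → a ≡ a′
  zigzagStep-prev-unique ((_ , fabc) , (fbcd , d≢a) , _) ((_ , fabc′) , (_ , d≢a′) , _) refl refl refl =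
    third-unique (face-rotate fabc) (face-rotate fabc′) fbcd (d≢a ∘ sym) (d≢a′ ∘ sym)

  Walk : (ℤ → Fin n) → Set
  Walk f = ∀ i → ZigzagStep T (f i) (f (i ℤ.+ + 1)) (f (i ℤ.+ + 2)) (f (i ℤ.+ + 3))

  flagAt : (ℤ → Fin n) → ℤ → Flag
  flagAt f i = f i , f (i ℤ.+ + 1) , f (i ℤ.+ + 2)

  flagAt-suc : ∀ f i → flagAt f (i ℤ.+ + 1) ≡ (f (i ℤ.+ + 1) , f (i ℤ.+ + 2) , f (i ℤ.+ + 3))
  flagAt-suc f i rewrite ℤP.+-assoc i (+ 1) (+ 1) | ℤP.+-assoc i (+ 1) (+ 2) = refl

  module _ {f g : ℤ → Fin n} (walk-f : Walk f) (walk-g : Walk g) where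

    walks-agree-suc : ∀ i j → flagAt f i ≡ flagAt g j → flagAt f (i ℤ.+ + 1) ≡ flagAt g (j ℤ.+ + 1)
    walks-agree-suc i j e with flag-injective e
    ... | p , q , r rewrite flagAt-suc f i | flagAt-suc g j =
      flag-≡ q r (zigzagStep-next-unique (walk-f i) (walk-g j) p q r)

    walks-agree-pred : ∀ i j → flagAt f (i ℤ.+ + 1) ≡ flagAt g (j ℤ.+ + 1) → flagAt f i ≡ flagAt g j
    walks-agree-pred i j e rewrite flagAt-suc f i | flagAt-suc g j with flag-injective e
    ... | p , q , r = flag-≡ (zigzagStep-prev-unique (walk-f i) (walk-g j) p q r) p q

    walks-agree : ∀ i j → flagAt f i ≡ flagAt g j → ∀ k → flagAt f (i ℤ.+ k) ≡ flagAt g (j ℤ.+ k)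
    walks-agree i j e = ℤ-bi-induction (λ k → flagAt f (i ℤ.+ k) ≡ flagAt g (j ℤ.+ k)) start up down
      where
      start : flagAt f (i ℤ.+ + 0) ≡ flagAt g (j ℤ.+ + 0)
      start rewrite ℤP.+-identityʳ i | ℤP.+-identityʳ j = e
      up : ∀ k → flagAt f (i ℤ.+ k) ≡ flagAt g (j ℤ.+ k) →
           flagAt f (i ℤ.+ (k ℤ.+ + 1)) ≡ flagAt g (j ℤ.+ (k ℤ.+ + 1))
      up k h rewrite sym (ℤP.+-assoc i k (+ 1)) | sym (ℤP.+-assoc j k (+ 1)) =
        walks-agree-suc (i ℤ.+ k) (j ℤ.+ k) h
      down : ∀ k → flagAt f (i ℤ.+ (k ℤ.+ + 1)) ≡ flagAt g (j ℤ.+ (k ℤ.+ + 1)) →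
             flagAt f (i ℤ.+ k) ≡ flagAt g (j ℤ.+ k)
      down k h rewrite sym (ℤP.+-assoc i k (+ 1)) | sym (ℤP.+-assoc j k (+ 1)) =
        walks-agree-pred (i ℤ.+ k) (j ℤ.+ k) h

    walks-agree-vertex : ∀ {i j} → flagAt f i ≡ flagAt g j → ∀ m → g m ≡ f (m ℤ.+ (i ℤ.- j))
    walks-agree-vertex {i} {j} e m =
      sym (trans (cong f (shift i j m)) (trans (cong proj₁ (walks-agree i j e (m ℤ.- j))) (cong g (cancel j m))))
      where
      shift : ∀ i j m → m ℤ.+ (i ℤ.- j) ≡ i ℤ.+ (m ℤ.- j)
      shift = solve-∀
      cancel : ∀ j m → j ℤ.+ (m ℤ.- j) ≡ m
      cancel = solve-∀

  walk-reverse : ∀ {f} → Walk f → ∀ t → Walk (λ i → f (t ℤ.- i))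
  walk-reverse {f} walk t i =
    zigzagStep-≡ (cong f (back₃ t i)) (cong f (back₂ t i)) (cong f (back₁ t i)) refl
      (zigzagStep-reverse (walk (t ℤ.- (i ℤ.+ + 3))))
    where
    back₃ : ∀ t i → (t ℤ.- (i ℤ.+ + 3)) ℤ.+ + 3 ≡ t ℤ.- i
    back₃ = solve-∀
    back₂ : ∀ t i → (t ℤ.- (i ℤ.+ + 3)) ℤ.+ + 2 ≡ t ℤ.- (i ℤ.+ + 1)
    back₂ = solve-∀
    back₁ : ∀ t i → (t ℤ.- (i ℤ.+ + 3)) ℤ.+ + 1 ≡ t ℤ.- (i ℤ.+ + 2)
    back₁ = solve-∀

  sameEdge-successor : SameEdge T a b c d → SameEdge T b x d y → a ≢ x → d ≡ b
  sameEdge-successor (inj₁ (_ , b≡d)) _                   _   = sym b≡d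
  sameEdge-successor (inj₂ _)         (inj₁ (b≡d , _))    _   = sym b≡d
  sameEdge-successor (inj₂ (a≡d , _)) (inj₂ (_ , x≡d))    a≢x = ⊥-elim (a≢x (trans a≡d (sym x≡d)))

  -- Finitely many flags, each determining the whole walk, make every walk periodic;
  -- its least return time is then a minimal period.
  module WalkPeriod {f : ℤ → Fin n} (walk : Walk f) where

    flag-code : Flag → Fin (n ℕ.* (n ℕ.* n))
    flag-code (a , b , c) = Fin.combine a (Fin.combine b c)

    flag-code-injective : ∀ s t → flag-code s ≡ flag-code t → s ≡ t
    flag-code-injective (a , b , c) (a′ , b′ , c′) e with FinP.combine-injective a _ a′ _ e
    ... | refl , e′ with FinP.combine-injective b c b′ c′ e′
    ... | refl , refl = refl

    ReturnsAfter : ℕ → Set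
    ReturnsAfter K = 0 < K × flagAt f (+ K) ≡ flagAt f (+ 0)

    returns : Σ ℕ ReturnsAfter
    returns with FinP.pigeonhole (ℕP.n<1+n _) (flag-code ∘ flagAt f ∘ +_ ∘ Fin.toℕ)
    ... | i , j , i<j , same-code =
      Fin.toℕ j ℕ.∸ Fin.toℕ i , ℕP.m<n⇒0<n∸m i<j ,
      subst₂ (λ k l → flagAt f k ≡ flagAt f l)
        (trans (ℤP.m-n≡m⊖n (Fin.toℕ j) (Fin.toℕ i)) (ℤP.⊖-≥ (ℕP.<⇒≤ i<j)))
        (ℤP.+-inverseʳ (+ Fin.toℕ i))
        (walks-agree walk walk _ _ (sym (flag-code-injective _ _ same-code)) (ℤ.- + Fin.toℕ i))

    period : Σ ℕ λ K → ReturnsAfter K × (∀ {j} → j < K → ¬ ReturnsAfter j)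
    period = least-witness (λ K → (0 ℕ.<? K) ×-dec (flagAt f (+ K) ≟-flag flagAt f (+ 0))) (proj₂ returns)

    edge-period⇒returns : ∀ m →
      (∀ i → SameEdge T (f i) (f (i ℤ.+ + 1)) (f (i ℤ.+ + m)) (f (i ℤ.+ + m ℤ.+ + 1))) →
      flagAt f (+ m) ≡ flagAt f (+ 0)
    edge-period⇒returns m same =
      flag-≡ first (next-agrees 0) (trans (cong (f ∘ +_) (ℕP.+-suc m 1)) (next-agrees 1))
      where
      swap-1-m : ∀ k m → k ℕ.+ 1 ℕ.+ m ≡ k ℕ.+ m ℕ.+ 1
      swap-1-m = ℕ-Solver.solve-∀
      next-agrees : ∀ k → f (+ (k ℕ.+ m ℕ.+ 1)) ≡ f (+ (k ℕ.+ 1))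
      next-agrees k = sameEdge-successor (same (+ k))
        (subst (λ l → SameEdge T (f (+ (k ℕ.+ 1))) (f (+ (k ℕ.+ 1 ℕ.+ 1)))
                                 (f (+ l)) (f (+ (k ℕ.+ 1 ℕ.+ m ℕ.+ 1))))
               (swap-1-m k m) (same (+ (k ℕ.+ 1))))
        (λ e → proj₁ (proj₁ (walk (+ k))) (trans e (cong (f ∘ +_) (ℕP.+-assoc k 1 1))))
      first : f (+ m) ≡ f (+ 0)
      first with same (+ 0)
      ... | inj₁ (f₀≡fₘ , _)   = sym f₀≡fₘ
      ... | inj₂ (f₀≡fₘ₊₁ , _) =
        ⊥-elim (face-irr (proj₂ (proj₁ (walk (+ 0)))) (trans f₀≡fₘ₊₁ (next-agrees 0)))

  walkZigzag : ∀ {f} → Walk f → Zigzag T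
  walkZigzag {f} walk = record
    { len      = K
    ; len>0    = proj₁ returns-K
    ; vtx      = f
    ; periodic = λ i → sym (trans (walks-agree-vertex walk walk (proj₂ returns-K) i)
                                   (cong (λ k → f (i ℤ.+ k)) (ℤP.+-identityʳ (+ K))))
    ; step     = walk
    ; minimal  = λ m 0<m m<K same → below-K m<K (0<m , edge-period⇒returns m same)
    }
    where
    open WalkPeriod walk
    K : ℕ
    K = proj₁ period
    returns-K : ReturnsAfter K
    returns-K = proj₁ (proj₂ period)
    below-K : ∀ {j} → j < K → ¬ ReturnsAfter j
    below-K = proj₂ (proj₂ period)

  zigzagStep-flip : (sf : SecondFace u w c) → ZigzagStep T a u w x →
                    (a ≡ c × x ≡ SecondFace.apex sf) ⊎ (a ≡ SecondFace.apex sf × x ≡ c)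
  zigzagStep-flip sf ((_ , fauw) , (fuwx , x≢a) , _)
    with SecondFace.two-faces sf _ (face-rotate fauw) | SecondFace.two-faces sf _ fuwx
  ... | inj₁ refl | inj₁ refl = ⊥-elim (x≢a refl)
  ... | inj₁ a≡c  | inj₂ x≡d  = inj₁ (a≡c , x≡d)
  ... | inj₂ a≡d  | inj₁ x≡c  = inj₂ (a≡d , x≡c)
  ... | inj₂ refl | inj₂ refl = ⊥-elim (x≢a refl)

  module _ (Z : Zigzag T) where
    private
      f : ℤ → Fin n
      f = vtx Z
      L : ℕ
      L = len Z

    Visits : Flag → Set
    Visits s = Σ ℤ λ i → flagAt f i ≡ s

    occ : Flag → ℕ
    occ s = countTo T L (⌊_⌋ ∘ λ k → flagAt f (+ k) ≟-flag s)

    flagAt-periodic : ∀ i → flagAt f (i ℤ.+ + L) ≡ flagAt f i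
    flagAt-periodic i = flag-≡ (periodic Z i) (shifted 1) (shifted 2)
      where
      shifted : ∀ k → f ((i ℤ.+ + L) ℤ.+ + k) ≡ f (i ℤ.+ + k)
      shifted k = trans (cong f (+-right-comm i (+ L) (+ k))) (periodic Z (i ℤ.+ + k))

    flag-in-period : ∀ i → Σ ℕ λ r → r < L × flagAt f i ≡ flagAt f (+ r)
    flag-in-period = ℤ-bi-induction _ (0 , len>0 Z , refl) up down
      where
      up : ∀ i → Σ ℕ (λ r → r < L × flagAt f i ≡ flagAt f (+ r)) →
           Σ ℕ λ r → r < L × flagAt f (i ℤ.+ + 1) ≡ flagAt f (+ r)
      up i (r , r<L , e) with walks-agree-suc (step Z) (step Z) i (+ r) e | suc r ℕ.<? L
      ... | e′ | yes 1+r<L = suc r , 1+r<L , trans e′ (cong (flagAt f ∘ +_) (ℕP.+-comm r 1))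
      ... | e′ | no 1+r≮L  = 0 , len>0 Z ,
        trans e′ (trans (cong (flagAt f ∘ +_) (trans (ℕP.+-comm r 1) (ℕP.≤-antisym r<L (ℕP.≮⇒≥ 1+r≮L))))
                        (flagAt-periodic (+ 0)))
      down : ∀ i → Σ ℕ (λ r → r < L × flagAt f (i ℤ.+ + 1) ≡ flagAt f (+ r)) →
             Σ ℕ λ r → r < L × flagAt f i ≡ flagAt f (+ r)
      down i (suc r , 1+r<L , e) = r , ℕP.<-trans (ℕP.n<1+n r) 1+r<L ,
        walks-agree-pred (step Z) (step Z) i (+ r) (trans e (cong (flagAt f ∘ +_) (ℕP.+-comm 1 r)))
      down i (zero , _ , e) = p , subst (p <_) p+1≡L (ℕP.n<1+n p) ,
        walks-agree-pred (step Z) (step Z) i (+ p)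
          (trans e (trans (sym (flagAt-periodic (+ 0))) (cong (flagAt f ∘ +_) (sym p+1≡L′))))
        where
        p : ℕ
        p = ℕ.pred L
        p+1≡L : suc p ≡ L
        p+1≡L = ℕP.suc-pred L {{ℕ.>-nonZero (len>0 Z)}}
        p+1≡L′ : p ℕ.+ 1 ≡ L
        p+1≡L′ = trans (ℕP.+-comm p 1) p+1≡L

    flags-distinct : ∀ {r r′} → r < r′ → r′ < L → flagAt f (+ r) ≢ flagAt f (+ r′)
    flags-distinct {r} {r′} r<r′ r′<L e =
      minimal Z m (ℕP.m<n⇒0<n∸m r<r′) (ℕP.≤-<-trans (ℕP.m∸n≤m r′ r) r′<L)
        λ i → inj₁ (shift i , trans (shift (i ℤ.+ + 1)) (cong f (+-right-comm i (+ 1) (+ m))))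
      where
      m : ℕ
      m = r′ ℕ.∸ r
      shift : ∀ i → f i ≡ f (i ℤ.+ + m)
      shift i = trans (walks-agree-vertex (step Z) (step Z) (sym e) i)
                      (cong (λ k → f (i ℤ.+ k)) (trans (ℤP.m-n≡m⊖n r′ r) (ℤP.⊖-≥ (ℕP.<⇒≤ r<r′))))

    visits? : ∀ s → Dec (Visits s)
    visits? s = Dec.map′ (λ (k , _ , e) → + k , e) in-period (ℕP.anyUpTo? (λ k → flagAt f (+ k) ≟-flag s) L)
      where
      in-period : Visits s → Σ ℕ λ k → k < L × flagAt f (+ k) ≡ s
      in-period (i , e) with flag-in-period i
      ... | r , r<L , e′ = r , r<L , trans (sym e′) e

    occ-visited : ∀ {s} → Visits s → occ s ≡ 1
    occ-visited {s} (i , e) with flag-in-period i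
    ... | r , r<L , e′ = count-unique L (λ k → flagAt f (+ k) ≟-flag s) r<L at-r unique
      where
      at-r : flagAt f (+ r) ≡ s
      at-r = trans (sym e′) e
      unique : ∀ {k} → k < L → flagAt f (+ k) ≡ s → k ≡ r
      unique {k} k<L at-k with ℕP.<-cmp k r
      ... | tri< k<r _ _ = ⊥-elim (flags-distinct k<r r<L (trans at-k (sym at-r)))
      ... | tri≈ _ k≡r _ = k≡r
      ... | tri> _ _ r<k = ⊥-elim (flags-distinct r<k k<L (trans at-r (sym at-k)))

    occ-unvisited : ∀ {s} → ¬ Visits s → occ s ≡ 0
    occ-unvisited {s} unvisited = count-none L (λ k → flagAt f (+ k) ≟-flag s) λ {k} _ e → unvisited (+ k , e)

    occ-cong : ∀ {s t} → (Visits s → Visits t) → (Visits t → Visits s) → occ s ≡ occ t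
    occ-cong {s} {t} s⇒t t⇒s with visits? s | visits? t
    ... | yes vs | _      = trans (occ-visited vs) (sym (occ-visited (s⇒t vs)))
    ... | no ¬vs | yes vt = ⊥-elim (¬vs (t⇒s vt))
    ... | no ¬vs | no ¬vt = trans (occ-unvisited ¬vs) (sym (occ-unvisited ¬vt))

    travZ-by-flags : Face u w c → travZ T Z u w ≡ occ (u , w , c) ℕ.+ occ (c , u , w)
    travZ-by-flags {u} {w} {c} fc =
      trans by-third-vertex (cong (occ (u , w , c) ℕ.+_) (occ-cong visits-prev visits-next))
      where
      sf : SecondFace u w c
      sf = second-face fc
      open SecondFace sf

      traversal-flag : ∀ k → f (+ k) ≡ u × f (+ k ℤ.+ + 1) ≡ w →
                       flagAt f (+ k) ≡ (u , w , c) ⊎ flagAt f (+ k) ≡ (u , w , apex)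
      traversal-flag k (p , q) =
        Sum.map (flag-≡ p q) (flag-≡ p q)
          (two-faces _ (subst₂ (λ a b → Face a b _) p q (proj₂ (proj₁ (step Z (+ k))))))

      flag-prefix : ∀ {x} {s : Flag} → s ≡ (u , w , x) → proj₁ s ≡ u × proj₁ (proj₂ s) ≡ w
      flag-prefix refl = refl , refl

      by-third-vertex : travZ T Z u w ≡ occ (u , w , c) ℕ.+ occ (u , w , apex)
      by-third-vertex = count-+ L _ _ _ λ {k} _ →
        trans (cong bit (⌊⌋-×-dec (f (+ k) Fin.≟ u) (f (+ k ℤ.+ + 1) Fin.≟ w)))
              (bit-⊎ ((f (+ k) Fin.≟ u) ×-dec (f (+ k ℤ.+ + 1) Fin.≟ w)) (_ ≟-flag _) (_ ≟-flag _)
                     (traversal-flag k) flag-prefix flag-prefix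
                     (λ e e′ → apex≢ (sym (proj₂ (proj₂ (flag-injective (trans (sym e) e′)))))))

      pred-suc : ∀ i → (i ℤ.- + 1) ℤ.+ + 1 ≡ i
      pred-suc = solve-∀

      visits-next : Visits (c , u , w) → Visits (u , w , apex)
      visits-next (i , e) with flag-injective e
      ... | p , q , r with zigzagStep-flip sf (zigzagStep-≡ p q r refl (step Z i))
      ... | inj₁ (_ , x≡d) = i ℤ.+ + 1 , trans (flagAt-suc f i) (flag-≡ q r x≡d)
      ... | inj₂ (c≡d , _) = ⊥-elim (apex≢ (sym c≡d))

      visits-prev : Visits (u , w , apex) → Visits (c , u , w)
      visits-prev (i , e)
        with flag-injective (trans (sym (flagAt-suc f (i ℤ.- + 1))) (trans (cong (flagAt f) (pred-suc i)) e))
      ... | p , q , r with zigzagStep-flip sf (zigzagStep-≡ refl p q r (step Z (i ℤ.- + 1)))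
      ... | inj₁ (a≡c , _) = i ℤ.- + 1 , flag-≡ a≡c p q
      ... | inj₂ (_ , d≡c) = ⊥-elim (apex≢ d≡c)

  module _ (X Y : Zigzag T) where

    visits-sameCyclic : ∀ {s} → Visits X s → Visits Y s → SameCyclic T X Y
    visits-sameCyclic (i , eX) (j , eY) = i ℤ.- j , walks-agree-vertex (step X) (step Y) (trans eX (sym eY))

    visits-isReverse : Visits X (a , b , c) → Visits Y (c , b , a) → IsReverse T Y X
    visits-isReverse (i , eX) (j , eY) with flag-injective eX | flag-injective eY
    ... | p , q , r | p′ , q′ , r′ =
      t , λ m → trans (walks-agree-vertex (walk-reverse (step X) t) (step Y) reversed-flag m)
                      (cong (vtx X) (drop-shift t j m))
      where
      t : ℤ
      t = (i ℤ.+ j) ℤ.+ + 2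
      at₀ : ∀ i j → ((i ℤ.+ j) ℤ.+ + 2) ℤ.- j ≡ i ℤ.+ + 2
      at₀ = solve-∀
      at₁ : ∀ i j → ((i ℤ.+ j) ℤ.+ + 2) ℤ.- (j ℤ.+ + 1) ≡ i ℤ.+ + 1
      at₁ = solve-∀
      at₂ : ∀ i j → ((i ℤ.+ j) ℤ.+ + 2) ℤ.- (j ℤ.+ + 2) ≡ i
      at₂ = solve-∀
      drop-shift : ∀ t j m → t ℤ.- (m ℤ.+ (j ℤ.- j)) ≡ t ℤ.- m
      drop-shift = solve-∀
      reversed-flag : flagAt (λ m → vtx X (t ℤ.- m)) j ≡ flagAt (vtx Y) j
      reversed-flag = flag-≡ (trans (cong (vtx X) (at₀ i j)) (trans r (sym p′)))
                             (trans (cong (vtx X) (at₁ i j)) (trans q (sym q′)))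
                             (trans (cong (vtx X) (at₂ i j)) (trans p (sym r′)))

    sameCyclic-visits : ∀ {s} → SameCyclic T X Y → Visits Y s → Visits X s
    sameCyclic-visits (t , h) (i , e) = i ℤ.+ t ,
      trans (flag-≡ (sym (h i)) (shifted 1) (shifted 2)) e
      where
      shifted : ∀ k → vtx X ((i ℤ.+ t) ℤ.+ + k) ≡ vtx Y (i ℤ.+ + k)
      shifted k = trans (cong (vtx X) (+-right-comm i t (+ k))) (sym (h (i ℤ.+ + k)))

    isReverse-visits : IsReverse T X Y → Visits Y (a , b , c) → Visits X (c , b , a)
    isReverse-visits (t , h) (i , e) with flag-injective e
    ... | p , q , r = t ℤ.- (i ℤ.+ + 2) ,
      flag-≡ (trans (h _) (trans (cong (vtx Y) (back₀ t i)) r))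
             (trans (h _) (trans (cong (vtx Y) (back₁ t i)) q))
             (trans (h _) (trans (cong (vtx Y) (back₂ t i)) p))
      where
      back₀ : ∀ t i → t ℤ.- (t ℤ.- (i ℤ.+ + 2)) ≡ i ℤ.+ + 2
      back₀ = solve-∀
      back₁ : ∀ t i → t ℤ.- ((t ℤ.- (i ℤ.+ + 2)) ℤ.+ + 1) ≡ i ℤ.+ + 1
      back₁ = solve-∀
      back₂ : ∀ t i → t ℤ.- ((t ℤ.- (i ℤ.+ + 2)) ℤ.+ + 2) ≡ i
      back₂ = solve-∀

  occList : List (Zigzag T) → Flag → ℕ
  occList []       s = 0
  occList (Z ∷ Zs) s = occ Z s ℕ.+ occList Zs s

  occList-none : ∀ Zs {s} → (∀ j → ¬ Visits (lookup Zs j) s) → occList Zs s ≡ 0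
  occList-none []       none = refl
  occList-none (Z ∷ Zs) none = cong₂ ℕ._+_ (occ-unvisited Z (none Fin.zero)) (occList-none Zs (none ∘ Fin.suc))

  occList-unique : ∀ Zs {s} k → Visits (lookup Zs k) s → (∀ j → Visits (lookup Zs j) s → j ≡ k) →
                   occList Zs s ≡ 1
  occList-unique (Z ∷ Zs) Fin.zero    v unique =
    cong₂ ℕ._+_ (occ-visited Z v) (occList-none Zs λ j v′ → FinP.0≢1+n (sym (unique (Fin.suc j) v′)))
  occList-unique (Z ∷ Zs) (Fin.suc k) v unique =
    cong₂ ℕ._+_ (occ-unvisited Z λ v′ → FinP.0≢1+n (unique Fin.zero v′))
                (occList-unique Zs k v λ j v′ → FinP.suc-injective (unique (Fin.suc j) v′))

  record FaceFlag : Set where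
    constructor ⟨_,_,_∣_⟩
    field
      v₀ v₁ v₂ : Fin n
      face     : Face v₀ v₁ v₂
  open FaceFlag using (v₀; v₁; v₂)

  triple : FaceFlag → Flag
  triple s = v₀ s , v₁ s , v₂ s

  advance : FaceFlag → FaceFlag
  advance ⟨ a , b , c ∣ f ⟩ = ⟨ b , c , SecondFace.apex sf ∣ SecondFace.face sf ⟩
    where
    sf : SecondFace b c a
    sf = second-face (face-rotate f)

  reverse : FaceFlag → FaceFlag
  reverse ⟨ a , b , c ∣ f ⟩ = ⟨ c , b , a ∣ face-reverse f ⟩

  retreat : FaceFlag → FaceFlag
  retreat = reverse ∘ advance ∘ reverse

  advance-retreat : ∀ s → triple (advance (retreat s)) ≡ triple s
  advance-retreat ⟨ a , b , c ∣ f ⟩ = flag-≡ refl refl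
    (third-unique (SecondFace.face sf₂) f (face-swap₁ (SecondFace.face sf₁))
                  (SecondFace.apex≢ sf₂) (SecondFace.apex≢ sf₁ ∘ sym))
    where
    sf₁ : SecondFace b a c
    sf₁ = second-face (face-rotate (face-reverse f))
    sf₂ : SecondFace a b (SecondFace.apex sf₁)
    sf₂ = second-face (face-rotate (face-reverse (SecondFace.face sf₁)))

  advance-step : ∀ s → ZigzagStep T (v₀ s) (v₁ s) (v₂ s) (v₂ (advance s))
  advance-step ⟨ a , b , c ∣ f ⟩ =
    (face-irr (face-swap₂ f) , f) , (face , apex≢) ,
    (face-irr (face-swap₂ f) , apex≢ ∘ sym , face-irr (face-rotate f) , face-irr (face-swap₂ face))
    where open SecondFace (second-face (face-rotate f))

  orbit : FaceFlag → ℤ → FaceFlag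
  orbit s (+ zero)      = s
  orbit s (+ suc k)     = advance (orbit s (+ k))
  orbit s -[1+ zero ]   = retreat s
  orbit s -[1+ suc k ]  = retreat (orbit s -[1+ k ])

  module _ (s : FaceFlag) where

    orbit-suc : ∀ i → triple (orbit s (i ℤ.+ + 1)) ≡ triple (advance (orbit s i))
    orbit-suc (+ k)          = cong (triple ∘ orbit s ∘ +_) (ℕP.+-comm k 1)
    orbit-suc -[1+ zero ]    = sym (advance-retreat s)
    orbit-suc -[1+ suc k ]   = sym (advance-retreat (orbit s -[1+ k ]))

    orbit-flag : ∀ i → flagAt (v₀ ∘ orbit s) i ≡ triple (orbit s i)
    orbit-flag i = flag-≡ refl (proj₁ (flag-injective (orbit-suc i)))
      (trans (cong (v₀ ∘ orbit s) (sym (ℤP.+-assoc i (+ 1) (+ 1))))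
             (trans (proj₁ (flag-injective (orbit-suc (i ℤ.+ + 1))))
                    (proj₁ (proj₂ (flag-injective (orbit-suc i))))))

    orbit-walk : Walk (v₀ ∘ orbit s)
    orbit-walk i
      with flag-injective (trans (sym (flagAt-suc (v₀ ∘ orbit s) i))
                                 (trans (orbit-flag (i ℤ.+ + 1)) (orbit-suc i)))
    ... | p , q , r = zigzagStep-≡ refl (sym p) (sym q) (sym r) (advance-step (orbit s i))

  face-zigzag : Face a b c → Σ (Zigzag T) λ Z → Visits Z (a , b , c)
  face-zigzag f = walkZigzag (orbit-walk s) , + 0 , orbit-flag s (+ 0)
    where
    s : FaceFlag
    s = ⟨ _ , _ , _ ∣ f ⟩

  module _ (τ : ZOrientation T) where
    open ZOrientation τ

    occτ : Flag → ℕ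
    occτ = occList zs

    trav-by-flags : Face u w c → trav T τ u w ≡ occτ (u , w , c) ℕ.+ occτ (c , u , w)
    trav-by-flags {u} {w} {c} fc = over zs
      where
      over : ∀ Zs → sumList T τ Zs u w ≡ occList Zs (u , w , c) ℕ.+ occList Zs (c , u , w)
      over []       = refl
      over (Z ∷ Zs) = trans (cong₂ ℕ._+_ (travZ-by-flags Z fc) (over Zs))
                            (+-interchange (occ Z _) (occ Z _) (occList Zs _) (occList Zs _))

    visits-unique : ∀ k {s} → Visits (lookup zs k) s → ∀ j → Visits (lookup zs j) s → j ≡ k
    visits-unique k visits-k j visits-j = distinct j k (visits-sameCyclic (lookup zs j) (lookup zs k) visits-j visits-k)

    flag-xor-reverse : Face a b c →
      (occτ (a , b , c) ≡ 1 × occτ (c , b , a) ≡ 0) ⊎ (occτ (a , b , c) ≡ 0 × occτ (c , b , a) ≡ 1)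
    flag-xor-reverse {a} {b} {c} f with face-zigzag f
    ... | Z , visits with choice Z
    ... | inj₁ ((k , same) , ¬reversed) =
      inj₁ (occList-unique zs k visits-k (visits-unique k visits-k) ,
            occList-none zs λ j v → ¬reversed (j , visits-isReverse Z (lookup zs j) visits v))
      where
      visits-k : Visits (lookup zs k) (a , b , c)
      visits-k = sameCyclic-visits (lookup zs k) Z same visits
    ... | inj₂ (¬same , (k , reversed)) =
      inj₂ (occList-none zs (λ j v → ¬same (j , visits-sameCyclic (lookup zs j) Z v visits)) ,
            occList-unique zs k visits-k (visits-unique k visits-k))
      where
      visits-k : Visits (lookup zs k) (c , b , a)
      visits-k = isReverse-visits (lookup zs k) Z reversed visits

    flag-or-reverse : Face a b c → occτ (a , b , c) ≡ 1 ⊎ occτ (c , b , a) ≡ 1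
    flag-or-reverse = Sum.map proj₁ proj₂ ∘ flag-xor-reverse

    arc-from-flags : Face u w c → occτ (u , w , c) ≡ 1 ⊎ occτ (c , u , w) ≡ 1 → Arc T τ u w
    arc-from-flags f traversed
      with trav-by-flags f | trav-by-flags (face-swap₁ f)
         | flag-xor-reverse f | flag-xor-reverse (face-rotate (face-rotate f))
    ... | forth | back | inj₁ (p , p′) | inj₁ (q , q′) =
      inj₂ (trans forth (cong₂ ℕ._+_ p q) , trans back (cong₂ ℕ._+_ q′ p′))
    ... | forth | back | inj₁ (p , p′) | inj₂ (q , q′) =
      inj₁ (trans forth (cong₂ ℕ._+_ p q) , trans back (cong₂ ℕ._+_ q′ p′))
    ... | forth | back | inj₂ (p , p′) | inj₁ (q , q′) =
      inj₁ (trans forth (cong₂ ℕ._+_ p q) , trans back (cong₂ ℕ._+_ q′ p′))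
    ... | _     | _    | inj₂ (p , _)  | inj₂ (q , _)  =
      ⊥-elim (Sum.[ (λ e → ℕP.0≢1+n (trans (sym p) e)) , (λ e → ℕP.0≢1+n (trans (sym q) e)) ] traversed)

    face-cycle : Face a b c →
      (Arc T τ a b × Arc T τ b c × Arc T τ c a) ⊎ (Arc T τ a c × Arc T τ c b × Arc T τ b a)
    face-cycle {a} {b} {c} f =
      Sum.map (λ (ab , bc , ca) → arc-from-flags f ab , arc-from-flags f₁ bc , arc-from-flags f₂ ca)
              (λ (ac , cb , ba) → arc-from-flags (face-swap₂ f) ac , arc-from-flags (face-reverse f) cb ,
                                  arc-from-flags (face-swap₁ f) ba)
              (majority (flag-or-reverse f) (flag-or-reverse f₁) (flag-or-reverse f₂))
      where
      f₁ : Face b c a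
      f₁ = face-rotate f
      f₂ : Face c a b
      f₂ = face-rotate f₁

    closed-walk₃ : ∀ v → Σ (Fin n) λ a → Σ (Fin n) λ b → Arc T τ v a × Arc T τ a b × Arc T τ b v
    closed-walk₃ v with vertex-in-face v
    ... | a , b , f with face-cycle f
    ... | inj₁ (va , ab , bv) = a , b , va , ab , bv
    ... | inj₂ (vb , ba , av) = b , a , vb , ba , av

    edge-arcs : Edge u w → Star (Arc T τ) u w
    edge-arcs (c , f) with face-cycle f
    ... | inj₁ (uw , _ , _)  = uw ◅ ε
    ... | inj₂ (uc , cw , _) = uc ◅ cw ◅ ε

    arcs-strongly-connected : ∀ v w → Star (Arc T τ) v w
    arcs-strongly-connected v w = (edge-arcs ⋆) (connected v w)

    weight-nonZero : Arc T τ u w → ℕ.NonZero (weight T τ u w)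
    weight-nonZero (inj₁ (forth , back)) rewrite forth | back = _
    weight-nonZero (inj₂ (forth , back)) rewrite forth | back = _

    sumFinℕ-≥ : ∀ {k} (g : Fin k → ℕ) i → g i ℕ.≤ sumFinℕ T τ g
    sumFinℕ-≥ g Fin.zero    = ℕP.m≤m+n _ _
    sumFinℕ-≥ g (Fin.suc i) = ℕP.≤-trans (sumFinℕ-≥ (g ∘ Fin.suc) i) (ℕP.m≤n+m _ _)

    prob-nonNeg : ∀ u w → ℚ.NonNegative (prob T τ u w)
    prob-nonNeg u w with deg T τ u
    ... | zero  = _
    ... | suc k = ℚP.normalize-nonNeg (weight T τ u w) (suc k)

    prob-pos : Arc T τ u w → ℚ.Positive (prob T τ u w)
    prob-pos {u} {w} arc with deg T τ u | sumFinℕ-≥ (weight T τ u) w | weight-nonZero arc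
    ... | zero  | w≤0 | w≢0 = ⊥-elim (ℕ.≢-nonZero⁻¹ _ {{w≢0}} (ℕP.n≤0⇒n≡0 w≤0))
    ... | suc k | _   | w≢0 = ℚP.normalize-pos (weight T τ u w) (suc k) {{_}} {{w≢0}}

    sumFinℚ-nonNeg : ∀ {k} (g : Fin k → ℚ) → (∀ i → ℚ.NonNegative (g i)) →
                     ℚ.NonNegative (sumFinℚ T τ g)
    sumFinℚ-nonNeg {zero}  g nonNeg = _
    sumFinℚ-nonNeg {suc k} g nonNeg =
      ℚP.nonNeg+nonNeg⇒nonNeg (g Fin.zero) {{nonNeg Fin.zero}} _
                              {{sumFinℚ-nonNeg (g ∘ Fin.suc) (nonNeg ∘ Fin.suc)}}

    sumFinℚ-pos : ∀ {k} (g : Fin k → ℚ) → (∀ i → ℚ.NonNegative (g i)) → ∀ j → ℚ.Positive (g j) →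
                  ℚ.Positive (sumFinℚ T τ g)
    sumFinℚ-pos g nonNeg Fin.zero    pos =
      ℚP.pos+nonNeg⇒pos (g Fin.zero) {{pos}} _ {{sumFinℚ-nonNeg (g ∘ Fin.suc) (nonNeg ∘ Fin.suc)}}
    sumFinℚ-pos g nonNeg (Fin.suc j) pos =
      ℚP.nonNeg+pos⇒pos (g Fin.zero) {{nonNeg Fin.zero}} _
                        {{sumFinℚ-pos (g ∘ Fin.suc) (nonNeg ∘ Fin.suc) j pos}}

    probPow-nonNeg : ∀ k v w → ℚ.NonNegative (probPow T τ k v w)
    step-nonNeg : ∀ k v u w → ℚ.NonNegative (probPow T τ k v u ℚ.* prob T τ u w)

    probPow-nonNeg zero v w with v Fin.≟ w
    ... | yes _ = _
    ... | no _  = _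
    probPow-nonNeg (suc k) v w = sumFinℚ-nonNeg _ λ u → step-nonNeg k v u w

    step-nonNeg k v u w =
      ℚP.nonNeg*nonNeg⇒nonNeg (probPow T τ k v u) {{probPow-nonNeg k v u}} (prob T τ u w) {{prob-nonNeg u w}}

    probPow-refl : ∀ v → 0ℚ ℚ.< probPow T τ 0 v v
    probPow-refl v with v Fin.≟ v
    ... | yes _   = ℚP.positive⁻¹ 1ℚ
    ... | no v≢v  = ⊥-elim (v≢v refl)

    probPow-arc : ∀ {k v} → 0ℚ ℚ.< probPow T τ k v u → Arc T τ u w → 0ℚ ℚ.< probPow T τ (suc k) v w
    probPow-arc {u} {w} {k} {v} reach arc = ℚP.positive⁻¹ _
      {{sumFinℚ-pos _ (λ u′ → step-nonNeg k v u′ w) u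
         (ℚP.pos*pos⇒pos (probPow T τ k v u) {{ℚ.positive reach}} (prob T τ u w) {{prob-pos arc}})}}

    irreducible : Irreducible T τ
    irreducible v w =
      foldl (λ v w → Σ ℕ λ k → 0ℚ ℚ.< probPow T τ k v w)
            (λ (k , reach) arc → suc k , probPow-arc {k = k} reach arc) (0 , probPow-refl _)
            (arcs-strongly-connected v w)

proposition1 : ∀ {n : ℕ} (T : Triangulation n) (τ : ZOrientation T) →
    (∀ v → Σ (Fin n) λ a → Σ (Fin n) λ b →
       Arc T τ v a × Arc T τ a b × Arc T τ b v)
    × Irreducible T τ
proposition1 T τ = closed-walk₃ T τ , irreducible T τ
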